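{- Let $w$ be a finite string over $\{0,1\}$. If $w0$ and $w1$ are both colourable, then $\psi(w0)=\psi(w1)$. If $0w$ and $1w$ are both colourable, then $\psi(0w)=\psi(1w)$.
   Context: $\#w$ is the length, $\varepsilon$ the empty string; for $\#w\ge1$, $l(w)$ is $w$ without its last letter and $r(w)$ is $w$ without its first letter. $T^n$ is the alternating string of length $n$ starting with $0$ ($T^0=\varepsilon$, $T^n=T^{n-1}0$ for odd $n$, $T^n=T^{n-1}1$ for even $n\ge2$) and $CT^n$ its letterwise complement. $\xi$: $\xi(\varepsilon)=0$; $\xi(w)=1$ if $w=T^k$, $k\ge2$ even; $\xi(w)=-1$ if $w=CT^k$, $k\ge2$ even; otherwise $\xi(w)=\operatorname{sgn}(\xi(l(w))+\xi(r(w)))$. $\phi$: $\phi(\varepsilon)=0$; $\phi(w)=-1$ if $w=0^k$, $k$ odd; $\phi(w)=1$ if $w=1^k$, $k$ odd; otherwise $\phi(w)=\operatorname{sgn}(\phi(r(w))-\phi(l(w)))$. $\psi(w)=\xi(w)^{\#w}\phi(w)$ (with $0^0=1$); $w$ is colourable iff $\psi(w)\ne0$. -}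

module Defs where

open import Data.Bool using (Bool; true; false; if_then_else_; _∧_)
open import Data.Nat using (ℕ; zero; suc; _≤ᵇ_)
open import Data.List using (List; []; _∷_; _++_; [_]; length; map; replicate)
open import Data.List.Properties using (≡-dec)
open import Data.Integer using (ℤ; +_; -[1+_]; _+_; _-_; _^_; 0ℤ; 1ℤ; -1ℤ)
open import Relation.Nullary using (yes; no)
open import Relation.Nullary.Decidable using (⌊_⌋)
open import Relation.Binary.PropositionalEquality using (_≡_; refl; _≢_)
open import Relation.Binary.Definitions using (DecidableEquality)

even : ℕ → Bool
even zero = true
even (suc n) = if even n then false else true

data Bit : Set where
  𝟘 𝟙 : Bit

_≟B_ : DecidableEquality Bit
𝟘 ≟B 𝟘 = yes refl
𝟘 ≟B 𝟙 = no λ ()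
𝟙 ≟B 𝟘 = no λ ()
𝟙 ≟B 𝟙 = yes refl

-- finite strings over {0,1}; # w = length w
Str : Set
Str = List Bit

comp : Bit → Bit
comp 𝟘 = 𝟙
comp 𝟙 = 𝟘

l : Str → Str
l []           = []
l (x ∷ [])     = []
l (x ∷ y ∷ ys) = x ∷ l (y ∷ ys)

r : Str → Str
r []       = []
r (x ∷ xs) = xs

-- T^n alternating string of length n starting with 0; CT^n its complement
Tn : ℕ → Str
Tn zero    = []
Tn (suc n) = Tn n ++ [ (if even (suc n) then 𝟙 else 𝟘) ]

CTn : ℕ → Str
CTn n = map comp (Tn n)

_==_ : Str → Str → Bool
u == v = ⌊ ≡-dec _≟B_ u v ⌋

isTeven : Str → Bool
isTeven w = (w == Tn (length w)) ∧ even (length w) ∧ (2 ≤ᵇ length w)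

isCTeven : Str → Bool
isCTeven w = (w == CTn (length w)) ∧ even (length w) ∧ (2 ≤ᵇ length w)

is0odd : Str → Bool
is0odd w = (w == replicate (length w) 𝟘) ∧ (if even (length w) then false else true)

is1odd : Str → Bool
is1odd w = (w == replicate (length w) 𝟙) ∧ (if even (length w) then false else true)

sgn : ℤ → ℤ
sgn (+ zero)  = 0ℤ
sgn (+ suc _) = 1ℤ
sgn -[1+ _ ]  = -1ℤ

-- ξ and φ, defined by recursion on the length (the fuel n equals #w in use;
-- l w and r w have length #w - 1).
ξ-aux : ℕ → Str → ℤ
ξ-aux zero    w = 0ℤ
ξ-aux (suc n) w =
  if isTeven w then 1ℤ
  else if isCTeven w then -1ℤ
  else sgn (ξ-aux n (l w) + ξ-aux n (r w))

ξ : Str → ℤ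
ξ w = ξ-aux (length w) w

φ-aux : ℕ → Str → ℤ
φ-aux zero    w = 0ℤ
φ-aux (suc n) w =
  if is0odd w then -1ℤ
  else if is1odd w then 1ℤ
  else sgn (φ-aux n (r w) - φ-aux n (l w))

φ : Str → ℤ
φ w = φ-aux (length w) w

-- ψ(w) = ξ(w)^{#w} φ(w), with 0^0 = 1 (as in Data.Integer._^_)
ψ : Str → ℤ
ψ w = (ξ w ^ length w) Data.Integer.* φ w

Colourable : Str → Set
Colourable w = ψ w ≢ 0ℤ

-- Write a u b for the word u framed by the letters a and b. Since l (a u b) = a u and
-- r (a u b) = u b are framings of l u and r u, induction on the length of u shows that
-- framing leaves ξ unchanged when u is neither constant nor alternating, and negates φ when
-- u is not constant; the induction bottoms out at the words whose l or r is constant or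
-- alternating, on which ξ and φ are computed explicitly. Hence ψ (a u b) does not depend on
-- a and b for such u, nor for u alternating of positive even length, where ξ (a u b) = ±1
-- and a u b has even length. For every other u (constant, or alternating of odd length)
-- ξ (a u b) = sgn (σ b - σ a) with σ 0 = -1 and σ 1 = 1, which vanishes when a = b, so w0
-- and w1 (resp. 0w and 1w) are never both colourable.

module Submission where

open import Data.Bool using (Bool; true; false; if_then_else_; _∧_)
open import Data.Bool.Properties using (∧-zeroʳ)
open import Data.Empty using (⊥; ⊥-elim)
open import Data.Integer using (ℤ; +_; -[1+_]; _+_; _-_; -_; _*_; _^_; 0ℤ; 1ℤ; -1ℤ)
open import Data.Integer.Properties using (i≡j⇒i-j≡0; neg-distrib-+; *-identityˡ)
open import Data.List using ([]; _∷_; _++_; [_]; length; map; replicate; initLast; _∷ʳ′_)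
open import Data.List.Properties using (≡-dec; length-replicate; ++-assoc)
open import Data.Nat using (ℕ; zero; suc; _≤ᵇ_)
open import Data.Nat.Properties using (suc-injective)
open import Data.Product using (_×_; _,_)
open import Data.Sum using (_⊎_; inj₁; inj₂)
open import Relation.Nullary using (yes; no)
open import Relation.Binary.PropositionalEquality
  using (_≡_; refl; sym; trans; cong; cong₂; subst; module ≡-Reasoning)

open import Defs


true≢false : true ≡ false → ⊥
true≢false ()

_≡ᵇ_ : Bit → Bit → Bool
𝟘 ≡ᵇ 𝟘 = true
𝟘 ≡ᵇ 𝟙 = false
𝟙 ≡ᵇ 𝟘 = false
𝟙 ≡ᵇ 𝟙 = true

comp-involutive : ∀ x → comp (comp x) ≡ x
comp-involutive 𝟘 = refl
comp-involutive 𝟙 = refl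

both : {P : Bit → Set} → P 𝟘 → P 𝟙 → ∀ x → P x
both p₀ p₁ 𝟘 = p₀
both p₀ p₁ 𝟙 = p₁

all-pairs : {P : Bit → Bit → Set} → P 𝟘 𝟘 → P 𝟘 𝟙 → P 𝟙 𝟘 → P 𝟙 𝟙 → ∀ x y → P x y
all-pairs p₀₀ p₀₁ p₁₀ p₁₁ 𝟘 = both p₀₀ p₀₁
all-pairs p₀₀ p₀₁ p₁₀ p₁₁ 𝟙 = both p₁₀ p₁₁

σ : Bit → ℤ
σ 𝟘 = -1ℤ
σ 𝟙 = 1ℤ

slope : Bit → Bit → ℤ
slope a b = sgn (σ b - σ a)

twice : ℕ → ℕ
twice zero    = zero
twice (suc k) = suc (suc (twice k))

data Parity : ℕ → Set where
  is-twice     : ∀ k → Parity (twice k)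
  is-suc-twice : ∀ k → Parity (suc (twice k))

parity : ∀ n → Parity n
parity zero = is-twice zero
parity (suc n) with parity n
... | is-twice k     = is-suc-twice k
... | is-suc-twice k = is-twice (suc k)

even-twice : ∀ k → even (twice k) ≡ true
even-twice zero    = refl
even-twice (suc k) rewrite even-twice k = refl

oddᵇ : ℕ → Bool
oddᵇ n = if even n then false else true

oddᵇ-suc : ∀ n → oddᵇ (suc n) ≡ even n
oddᵇ-suc n with even n
... | true  = refl
... | false = refl

consistsOf : Bit → Str → Bool
consistsOf c []       = true
consistsOf c (y ∷ ys) = (y ≡ᵇ c) ∧ consistsOf c ys

alt : Bit → ℕ → Str
alt x zero    = []
alt x (suc n) = x ∷ alt (comp x) n

alternatesFrom : Bit → Str → Bool
alternatesFrom x []       = true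
alternatesFrom x (y ∷ ys) = (y ≡ᵇ x) ∧ alternatesFrom (comp x) ys

length-l : ∀ x t → length (l (x ∷ t)) ≡ length t
length-l x []      = refl
length-l x (y ∷ t) = cong suc (length-l y t)

length-∷ʳ : ∀ (w : Str) z → length (w ++ [ z ]) ≡ suc (length w)
length-∷ʳ []      z = refl
length-∷ʳ (x ∷ w) z = cong suc (length-∷ʳ w z)

length-frame : ∀ (a : Bit) u b → length (a ∷ u ++ [ b ]) ≡ suc (suc (length u))
length-frame a []      b = refl
length-frame a (x ∷ u) b = cong suc (length-frame x u b)

length-alt : ∀ x n → length (alt x n) ≡ n
length-alt x zero    = refl
length-alt x (suc n) = cong suc (length-alt (comp x) n)

l-∷ʳ : ∀ u b → l (u ++ [ b ]) ≡ u
l-∷ʳ []          b = refl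
l-∷ʳ (x ∷ [])    b = refl
l-∷ʳ (x ∷ y ∷ u) b = cong (x ∷_) (l-∷ʳ (y ∷ u) b)

replicate-∷ʳ : ∀ m (d : Bit) → replicate (suc m) d ≡ replicate m d ++ [ d ]
replicate-∷ʳ zero    d = refl
replicate-∷ʳ (suc m) d = cong (d ∷_) (replicate-∷ʳ m d)

l-replicate : ∀ m (d : Bit) → l (d ∷ replicate m d) ≡ replicate m d
l-replicate m d = trans (cong l (replicate-∷ʳ m d)) (l-∷ʳ (replicate m d) d)

alt-∷ʳ : ∀ x n → alt x (suc n) ≡ alt x n ++ [ (if even n then x else comp x) ]
alt-∷ʳ x zero    = refl
alt-∷ʳ x (suc n) = cong (x ∷_) (trans (alt-∷ʳ (comp x) n) (cong (λ z → alt (comp x) n ++ [ z ]) (last-letter (even n))))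
  where
  last-letter : ∀ b → (if b then comp x else comp (comp x)) ≡ (if (if b then false else true) then x else comp x)
  last-letter true  = refl
  last-letter false = comp-involutive x

l-alt : ∀ x n → l (alt x (suc n)) ≡ alt x n
l-alt x n = trans (cong l (alt-∷ʳ x n)) (l-∷ʳ (alt x n) _)

alt-odd-∷ʳ : ∀ x k → alt x (suc (twice k)) ≡ alt x (twice k) ++ [ x ]
alt-odd-∷ʳ x k rewrite alt-∷ʳ x (twice k) | even-twice k = refl

alt-even-∷ʳ : ∀ x k → alt x (twice (suc k)) ≡ alt x (suc (twice k)) ++ [ comp x ]
alt-even-∷ʳ x k = cong (x ∷_) (alt-odd-∷ʳ (comp x) k)


-- The recurrences for ξ and φ

==-∷ : ∀ x y xs ys → ((x ∷ xs) == (y ∷ ys)) ≡ (x ≡ᵇ y) ∧ (xs == ys)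
==-∷ 𝟘 𝟙 xs ys = refl
==-∷ 𝟙 𝟘 xs ys = refl
==-∷ 𝟘 𝟘 xs ys with ≡-dec _≟B_ xs ys
... | yes _ = refl
... | no _ = refl
==-∷ 𝟙 𝟙 xs ys with ≡-dec _≟B_ xs ys
... | yes _ = refl
... | no _ = refl

==⇒≡ : ∀ u v → (u == v) ≡ true → u ≡ v
==⇒≡ u v e with ≡-dec _≟B_ u v
==⇒≡ u v e  | yes u≡v = u≡v
==⇒≡ u v () | no _

==-replicate : ∀ c w → (w == replicate (length w) c) ≡ consistsOf c w
==-replicate c []       = refl
==-replicate c (y ∷ ys) = trans (==-∷ y c ys _) (cong ((y ≡ᵇ c) ∧_) (==-replicate c ys))

==-alt : ∀ x w → (w == alt x (length w)) ≡ alternatesFrom x w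
==-alt x []       = refl
==-alt x (y ∷ ys) = trans (==-∷ y x ys _) (cong ((y ≡ᵇ x) ∧_) (==-alt (comp x) ys))

Tn≡alt : ∀ n → Tn n ≡ alt 𝟘 n
Tn≡alt zero    = refl
Tn≡alt (suc n) = trans (cong₂ (λ u z → u ++ [ z ]) (Tn≡alt n) (last-letter (even n))) (sym (alt-∷ʳ 𝟘 n))
  where
  last-letter : ∀ b → (if (if b then false else true) then 𝟙 else 𝟘) ≡ (if b then 𝟘 else 𝟙)
  last-letter true  = refl
  last-letter false = refl

map-comp-alt : ∀ x n → map comp (alt x n) ≡ alt (comp x) n
map-comp-alt x zero    = refl
map-comp-alt x (suc n) = cong (comp x ∷_) (map-comp-alt (comp x) n)

CTn≡alt : ∀ n → CTn n ≡ alt 𝟙 n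
CTn≡alt n = trans (cong (map comp) (Tn≡alt n)) (map-comp-alt 𝟘 n)

evenAlt : Bit → Str → Bool
evenAlt x w = alternatesFrom x w ∧ even (length w) ∧ (2 ≤ᵇ length w)

oddConst : Bit → Str → Bool
oddConst c w = consistsOf c w ∧ oddᵇ (length w)

NotEvenAlt : Str → Set
NotEvenAlt w = ∀ z → evenAlt z w ≡ false

NonConstant : Str → Set
NonConstant u = ∀ c → consistsOf c u ≡ false

NonAlternating : Str → Set
NonAlternating u = ∀ z → alternatesFrom z u ≡ false

isTeven≡evenAlt : ∀ w → isTeven w ≡ evenAlt 𝟘 w
isTeven≡evenAlt w rewrite Tn≡alt (length w) | ==-alt 𝟘 w = refl

isCTeven≡evenAlt : ∀ w → isCTeven w ≡ evenAlt 𝟙 w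
isCTeven≡evenAlt w rewrite CTn≡alt (length w) | ==-alt 𝟙 w = refl

is0odd≡oddConst : ∀ w → is0odd w ≡ oddConst 𝟘 w
is0odd≡oddConst w rewrite ==-replicate 𝟘 w = refl

is1odd≡oddConst : ∀ w → is1odd w ≡ oddConst 𝟙 w
is1odd≡oddConst w rewrite ==-replicate 𝟙 w = refl

ξ-∷ : ∀ x t → ξ (x ∷ t) ≡
  (if evenAlt 𝟘 (x ∷ t) then 1ℤ else if evenAlt 𝟙 (x ∷ t) then -1ℤ else sgn (ξ (l (x ∷ t)) + ξ t))
ξ-∷ x t rewrite sym (isTeven≡evenAlt (x ∷ t)) | sym (isCTeven≡evenAlt (x ∷ t)) | sym (length-l x t) = refl

φ-∷ : ∀ x t → φ (x ∷ t) ≡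
  (if oddConst 𝟘 (x ∷ t) then -1ℤ else if oddConst 𝟙 (x ∷ t) then 1ℤ else sgn (φ t - φ (l (x ∷ t))))
φ-∷ x t rewrite sym (is0odd≡oddConst (x ∷ t)) | sym (is1odd≡oddConst (x ∷ t)) | sym (length-l x t) = refl

ξ-rec : ∀ x t → NotEvenAlt (x ∷ t) → ξ (x ∷ t) ≡ sgn (ξ (l (x ∷ t)) + ξ t)
ξ-rec x t h rewrite ξ-∷ x t | h 𝟘 | h 𝟙 = refl

φ-rec : ∀ x t → NonConstant (x ∷ t) → φ (x ∷ t) ≡ sgn (φ t - φ (l (x ∷ t)))
φ-rec x t h rewrite φ-∷ x t | h 𝟘 | h 𝟙 = refl

ξ-border : ∀ a u b → NotEvenAlt (a ∷ u ++ [ b ]) →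
  ξ (a ∷ u ++ [ b ]) ≡ sgn (ξ (a ∷ u) + ξ (u ++ [ b ]))
ξ-border a u b h rewrite ξ-rec a (u ++ [ b ]) h | l-∷ʳ (a ∷ u) b = refl

φ-border : ∀ a u b → NonConstant (a ∷ u ++ [ b ]) →
  φ (a ∷ u ++ [ b ]) ≡ sgn (φ (u ++ [ b ]) - φ (a ∷ u))
φ-border a u b h rewrite φ-rec a (u ++ [ b ]) h | l-∷ʳ (a ∷ u) b = refl


-- Recognising constant and alternating words

consistsOf-replicate : ∀ d m → consistsOf d (replicate m d) ≡ true
consistsOf-replicate 𝟘 zero    = refl
consistsOf-replicate 𝟘 (suc m) = consistsOf-replicate 𝟘 m
consistsOf-replicate 𝟙 zero    = refl
consistsOf-replicate 𝟙 (suc m) = consistsOf-replicate 𝟙 m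

consistsOf-∷ʳ : ∀ c u b → (b ≡ᵇ c) ≡ false → consistsOf c (u ++ [ b ]) ≡ false
consistsOf-∷ʳ c []      b b≢c rewrite b≢c = refl
consistsOf-∷ʳ c (y ∷ u) b b≢c rewrite consistsOf-∷ʳ c u b b≢c = ∧-zeroʳ (y ≡ᵇ c)

consistsOf-++ : ∀ c u v → consistsOf c u ≡ false → consistsOf c (u ++ v) ≡ false
consistsOf-++ c (y ∷ u) v h with y ≡ᵇ c
... | true  = consistsOf-++ c u v h
... | false = refl

consistsOf⇒≡replicate : ∀ c w → consistsOf c w ≡ true → w ≡ replicate (length w) c
consistsOf⇒≡replicate c w h = ==⇒≡ w _ (trans (==-replicate c w) h)

alternatesFrom-alt : ∀ x n → alternatesFrom x (alt x n) ≡ true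
alternatesFrom-alt x zero    = refl
alternatesFrom-alt 𝟘 (suc n) = alternatesFrom-alt 𝟙 n
alternatesFrom-alt 𝟙 (suc n) = alternatesFrom-alt 𝟘 n

alternatesFrom-++ : ∀ z u v → alternatesFrom z u ≡ false → alternatesFrom z (u ++ v) ≡ false
alternatesFrom-++ z (y ∷ u) v h with y ≡ᵇ z
... | true  = alternatesFrom-++ (comp z) u v h
... | false = refl

alternatesFrom⇒≡alt : ∀ x w → alternatesFrom x w ≡ true → w ≡ alt x (length w)
alternatesFrom⇒≡alt x w h = ==⇒≡ w _ (trans (==-alt x w) h)

¬nonConstant-replicate : ∀ m d → NonConstant (replicate m d) → ⊥
¬nonConstant-replicate m d h = true≢false (trans (sym (consistsOf-replicate d m)) (h d))

¬nonConstant-replicate-∷ʳ : ∀ m d → NonConstant (replicate m d ++ [ d ]) → ⊥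
¬nonConstant-replicate-∷ʳ m d h = ¬nonConstant-replicate (suc m) d (subst NonConstant (sym (replicate-∷ʳ m d)) h)

¬nonAlternating-alt : ∀ x n → NonAlternating (alt x n) → ⊥
¬nonAlternating-alt x n h = true≢false (trans (sym (alternatesFrom-alt x n)) (h x))

nonConstant-∷ : ∀ x t → consistsOf x t ≡ false → NonConstant (x ∷ t)
nonConstant-∷ 𝟘 t h = both h refl
nonConstant-∷ 𝟙 t h = both refl h

nonConstant-border : ∀ a u b → NonConstant u → NonConstant (a ∷ u ++ [ b ])
nonConstant-border a u b h c rewrite consistsOf-++ c u [ b ] (h c) = ∧-zeroʳ (a ≡ᵇ c)

nonConstant-comp∷ : ∀ a t → NonConstant (comp a ∷ a ∷ t)
nonConstant-comp∷ 𝟘 t = both refl refl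
nonConstant-comp∷ 𝟙 t = both refl refl

nonConstant-∷ʳ-comp : ∀ a u → NonConstant (a ∷ u ++ [ comp a ])
nonConstant-∷ʳ-comp 𝟘 u = both (consistsOf-∷ʳ 𝟘 u 𝟙 refl) refl
nonConstant-∷ʳ-comp 𝟙 u = both refl (consistsOf-∷ʳ 𝟙 u 𝟘 refl)

nonConstant-alt : ∀ x n → NonConstant (alt x (suc (suc n)))
nonConstant-alt 𝟘 n = both refl refl
nonConstant-alt 𝟙 n = both refl refl

nonAlternating⇒notEvenAlt : ∀ w → NonAlternating w → NotEvenAlt w
nonAlternating⇒notEvenAlt w h z rewrite h z = refl

odd⇒notEvenAlt : ∀ w → even (length w) ≡ false → NotEvenAlt w
odd⇒notEvenAlt w h z rewrite h = ∧-zeroʳ (alternatesFrom z w)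

nonAlternating-∷ : ∀ x t → NonAlternating t → NonAlternating (x ∷ t)
nonAlternating-∷ x t h z rewrite h (comp z) = ∧-zeroʳ (x ≡ᵇ z)

nonAlternating-∷-self : ∀ x t → alternatesFrom x (x ∷ t) ≡ false → NonAlternating (x ∷ t)
nonAlternating-∷-self 𝟘 t h = both h refl
nonAlternating-∷-self 𝟙 t h = both refl h

nonAlternating-twice : ∀ d t → NonAlternating (d ∷ d ∷ t)
nonAlternating-twice 𝟘 t = both refl refl
nonAlternating-twice 𝟙 t = both refl refl

nonAlternating-suffix : ∀ u v → NonAlternating v → NonAlternating (u ++ v)
nonAlternating-suffix []      v h = h
nonAlternating-suffix (y ∷ u) v h = nonAlternating-∷ y (u ++ v) (nonAlternating-suffix u v h)

nonAlternating-prefix : ∀ u v → NonAlternating u → NonAlternating (u ++ v)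
nonAlternating-prefix u v h z = alternatesFrom-++ z u v (h z)

nonAlternating-doubled-last : ∀ u d → NonAlternating ((u ++ [ d ]) ++ [ d ])
nonAlternating-doubled-last u d =
  subst NonAlternating (sym (++-assoc u [ d ] [ d ])) (nonAlternating-suffix u (d ∷ d ∷ []) (nonAlternating-twice d []))

nonAlternating-alt-even-∷ʳ : ∀ x k → NonAlternating (alt x (twice (suc k)) ++ [ comp x ])
nonAlternating-alt-even-∷ʳ x k =
  subst (λ v → NonAlternating (v ++ [ comp x ])) (sym (alt-even-∷ʳ x k)) (nonAlternating-doubled-last (alt x (suc (twice k))) (comp x))

nonAlternating-alt-odd-∷ʳ : ∀ x k → NonAlternating (alt x (suc (twice k)) ++ [ x ])
nonAlternating-alt-odd-∷ʳ x k =
  subst (λ v → NonAlternating (v ++ [ x ])) (sym (alt-odd-∷ʳ x k)) (nonAlternating-doubled-last (alt x (twice k)) x)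

notEvenAlt-frame : ∀ a u b → NonAlternating u → NotEvenAlt (a ∷ u ++ [ b ])
notEvenAlt-frame a u b h = nonAlternating⇒notEvenAlt (a ∷ u ++ [ b ]) (nonAlternating-∷ a (u ++ [ b ]) (nonAlternating-prefix u [ b ] h))

ξ-rec-nonAlternating : ∀ x t → NonAlternating (x ∷ t) → ξ (x ∷ t) ≡ sgn (ξ (l (x ∷ t)) + ξ t)
ξ-rec-nonAlternating x t h = ξ-rec x t (nonAlternating⇒notEvenAlt (x ∷ t) h)

evenAlt-alt : ∀ x k → evenAlt x (alt x (twice (suc k))) ≡ true
evenAlt-alt x k rewrite alternatesFrom-alt x (twice (suc k)) | length-alt (comp (comp x)) (twice k) | even-twice k = refl

even-alt-odd : ∀ x k → even (length (alt x (suc (twice k)))) ≡ false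
even-alt-odd x k rewrite length-alt (comp x) (twice k) | even-twice k = refl

even-frame-alt-odd : ∀ a x k b → even (length (a ∷ alt x (suc (twice k)) ++ [ b ])) ≡ false
even-frame-alt-odd a x k b =
  trans (cong even (trans (length-frame a (alt x (suc (twice k))) b) (cong (λ n → suc (suc n)) (length-alt x (suc (twice k))))))
        (odd-suc-twice (suc k))
  where
  odd-suc-twice : ∀ k → even (suc (twice k)) ≡ false
  odd-suc-twice k rewrite even-twice k = refl

data Constancy (w : Str) : Set where
  constant    : ∀ d → w ≡ replicate (length w) d → Constancy w
  nonConstant : NonConstant w → Constancy w

constancy : ∀ w → Constancy w
constancy []      = constant 𝟘 refl
constancy (x ∷ t) with consistsOf x t in eq
... | true  = constant x (cong (x ∷_) (consistsOf⇒≡replicate x t eq))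
... | false = nonConstant (nonConstant-∷ x t eq)

data Shape (w : Str) : Set where
  constant    : ∀ d → w ≡ replicate (length w) d → Shape w
  alternating : ∀ x → w ≡ alt x (length w) → Shape w
  irregular   : NonConstant w → NonAlternating w → Shape w

shape : ∀ w → Shape w
shape w with constancy w
shape w       | constant d eq = constant d eq
shape []      | nonConstant h = ⊥-elim (true≢false (h 𝟘))
shape (x ∷ t) | nonConstant h with alternatesFrom x (x ∷ t) in eq
... | true  = alternating x (alternatesFrom⇒≡alt x (x ∷ t) eq)
... | false = irregular h (nonAlternating-∷-self x t eq)


-- ξ and φ on constant words

oddConst-replicate : ∀ c d m → oddConst c (d ∷ replicate m d) ≡ (d ≡ᵇ c) ∧ even m
oddConst-replicate c d m rewrite length-replicate m {d} | oddᵇ-suc m = table c d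
  where
  table : ∀ c d → ((d ≡ᵇ c) ∧ consistsOf c (replicate m d)) ∧ even m ≡ (d ≡ᵇ c) ∧ even m
  table 𝟘 𝟘 rewrite consistsOf-replicate 𝟘 m = refl
  table 𝟘 𝟙 = refl
  table 𝟙 𝟘 = refl
  table 𝟙 𝟙 rewrite consistsOf-replicate 𝟙 m = refl

φ-replicate : ∀ m d → φ (replicate m d) ≡ (if even m then 0ℤ else σ d)
φ-replicate zero    d = refl
φ-replicate (suc m) d
  rewrite φ-∷ d (replicate m d) | oddConst-replicate 𝟘 d m | oddConst-replicate 𝟙 d m
        | l-replicate m d | i≡j⇒i-j≡0 (refl {x = φ (replicate m d)}) = table d (even m)
  where
  table : ∀ d e → (if (d ≡ᵇ 𝟘) ∧ e then -1ℤ else if (d ≡ᵇ 𝟙) ∧ e then 1ℤ else 0ℤ)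
                ≡ (if (if e then false else true) then 0ℤ else σ d)
  table 𝟘 true  = refl
  table 𝟘 false = refl
  table 𝟙 true  = refl
  table 𝟙 false = refl

φ-comp∷replicate : ∀ d m → φ (comp d ∷ replicate m d) ≡ (if even m then σ (comp d) else σ d)
φ-comp∷replicate 𝟘 zero    = refl
φ-comp∷replicate 𝟙 zero    = refl
φ-comp∷replicate d (suc m) =
  begin
    φ (comp d ∷ d ∷ replicate m d)
  ≡⟨ φ-rec (comp d) (d ∷ replicate m d) (nonConstant-comp∷ d (replicate m d)) ⟩
    sgn (φ (d ∷ replicate m d) - φ (comp d ∷ l (d ∷ replicate m d)))
  ≡⟨ cong (λ v → sgn (φ (d ∷ replicate m d) - φ (comp d ∷ v))) (l-replicate m d) ⟩
    sgn (φ (replicate (suc m) d) - φ (comp d ∷ replicate m d))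
  ≡⟨ cong₂ (λ p q → sgn (p - q)) (φ-replicate (suc m) d) (φ-comp∷replicate d m) ⟩
    sgn ((if even (suc m) then 0ℤ else σ d) - (if even m then σ (comp d) else σ d))
  ≡⟨ table d (even m) ⟩
    (if even (suc m) then σ (comp d) else σ d)
  ∎
  where
  open ≡-Reasoning
  table : ∀ d e → sgn ((if (if e then false else true) then 0ℤ else σ d) - (if e then σ (comp d) else σ d))
                ≡ (if (if e then false else true) then σ (comp d) else σ d)
  table 𝟘 true  = refl
  table 𝟘 false = refl
  table 𝟙 true  = refl
  table 𝟙 false = refl

φ-replicate-∷ʳcomp : ∀ d m → φ (replicate m d ++ [ comp d ]) ≡ σ (comp d)
φ-replicate-∷ʳcomp 𝟘 zero    = refl
φ-replicate-∷ʳcomp 𝟙 zero    = refl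
φ-replicate-∷ʳcomp d (suc m) =
  begin
    φ (d ∷ replicate m d ++ [ comp d ])
  ≡⟨ φ-rec d (replicate m d ++ [ comp d ]) (nonConstant-∷ʳ-comp d (replicate m d)) ⟩
    sgn (φ (replicate m d ++ [ comp d ]) - φ (l (d ∷ replicate m d ++ [ comp d ])))
  ≡⟨ cong (λ v → sgn (φ (replicate m d ++ [ comp d ]) - φ v)) (l-∷ʳ (d ∷ replicate m d) (comp d)) ⟩
    sgn (φ (replicate m d ++ [ comp d ]) - φ (replicate (suc m) d))
  ≡⟨ cong₂ (λ p q → sgn (p - q)) (φ-replicate-∷ʳcomp d m) (φ-replicate (suc m) d) ⟩
    sgn (σ (comp d) - (if even (suc m) then 0ℤ else σ d))
  ≡⟨ table d (even (suc m)) ⟩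
    σ (comp d)
  ∎
  where
  open ≡-Reasoning
  table : ∀ d e → sgn (σ (comp d) - (if e then 0ℤ else σ d)) ≡ σ (comp d)
  table 𝟘 true  = refl
  table 𝟘 false = refl
  table 𝟙 true  = refl
  table 𝟙 false = refl

φ-aroundConstant : Bit → Bit → Bool → Bit → ℤ
φ-aroundConstant a d e b = if e then slope a b else (if (a ≡ᵇ d) ∧ (b ≡ᵇ d) then σ d else - σ d)

φ-pair : ∀ a b → φ (a ∷ [ b ]) ≡ slope a b
φ-pair 𝟘 𝟘 = refl
φ-pair 𝟘 𝟙 = refl
φ-pair 𝟙 𝟘 = refl
φ-pair 𝟙 𝟙 = refl

φ-aroundConstant-same : ∀ d m → φ (d ∷ replicate m d ++ [ d ]) ≡ φ-aroundConstant d d (even m) d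
φ-aroundConstant-same d m =
  trans (cong (λ v → φ (d ∷ v)) (sym (replicate-∷ʳ m d)))
        (trans (φ-replicate (suc (suc m)) d) (table d (even m)))
  where
  table : ∀ d e → (if (if (if e then false else true) then false else true) then 0ℤ else σ d)
                ≡ φ-aroundConstant d d e d
  table 𝟘 true  = refl
  table 𝟘 false = refl
  table 𝟙 true  = refl
  table 𝟙 false = refl

φ-aroundConstant-rec : ∀ a d b e → NonConstant (a ∷ d ∷ [ b ]) →
  sgn (φ-aroundConstant d d e b - φ-aroundConstant a d e d) ≡ φ-aroundConstant a d (if e then false else true) b
φ-aroundConstant-rec 𝟘 𝟘 𝟘 e h = ⊥-elim (true≢false (h 𝟘))
φ-aroundConstant-rec 𝟙 𝟙 𝟙 e h = ⊥-elim (true≢false (h 𝟙))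
φ-aroundConstant-rec 𝟘 𝟘 𝟙 true  _ = refl
φ-aroundConstant-rec 𝟘 𝟘 𝟙 false _ = refl
φ-aroundConstant-rec 𝟘 𝟙 𝟘 true  _ = refl
φ-aroundConstant-rec 𝟘 𝟙 𝟘 false _ = refl
φ-aroundConstant-rec 𝟘 𝟙 𝟙 true  _ = refl
φ-aroundConstant-rec 𝟘 𝟙 𝟙 false _ = refl
φ-aroundConstant-rec 𝟙 𝟘 𝟘 true  _ = refl
φ-aroundConstant-rec 𝟙 𝟘 𝟘 false _ = refl
φ-aroundConstant-rec 𝟙 𝟘 𝟙 true  _ = refl
φ-aroundConstant-rec 𝟙 𝟘 𝟙 false _ = refl
φ-aroundConstant-rec 𝟙 𝟙 𝟘 true  _ = refl
φ-aroundConstant-rec 𝟙 𝟙 𝟘 false _ = refl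

mutual
  φ-border-replicate : ∀ a d m b → φ (a ∷ replicate m d ++ [ b ]) ≡ φ-aroundConstant a d (even m) b
  φ-border-replicate 𝟘 𝟘 m       𝟘 = φ-aroundConstant-same 𝟘 m
  φ-border-replicate 𝟙 𝟙 m       𝟙 = φ-aroundConstant-same 𝟙 m
  φ-border-replicate a d zero    b = φ-pair a b
  φ-border-replicate 𝟘 𝟙 (suc m) b =
    φ-border-replicate-suc 𝟘 𝟙 m b (nonConstant-comp∷ 𝟙 (replicate m 𝟙 ++ [ b ])) (both refl refl)
  φ-border-replicate 𝟙 𝟘 (suc m) b =
    φ-border-replicate-suc 𝟙 𝟘 m b (nonConstant-comp∷ 𝟘 (replicate m 𝟘 ++ [ b ])) (both refl refl)
  φ-border-replicate 𝟘 𝟘 (suc m) 𝟙 =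
    φ-border-replicate-suc 𝟘 𝟘 m 𝟙 (nonConstant-∷ʳ-comp 𝟘 (𝟘 ∷ replicate m 𝟘)) (both refl refl)
  φ-border-replicate 𝟙 𝟙 (suc m) 𝟘 =
    φ-border-replicate-suc 𝟙 𝟙 m 𝟘 (nonConstant-∷ʳ-comp 𝟙 (𝟙 ∷ replicate m 𝟙)) (both refl refl)

  φ-border-replicate-suc : ∀ a d m b → NonConstant (a ∷ d ∷ replicate m d ++ [ b ]) → NonConstant (a ∷ d ∷ [ b ]) →
    φ (a ∷ d ∷ replicate m d ++ [ b ]) ≡ φ-aroundConstant a d (even (suc m)) b
  φ-border-replicate-suc a d m b long short =
    begin
      φ (a ∷ (d ∷ replicate m d) ++ [ b ])
    ≡⟨ φ-border a (d ∷ replicate m d) b long ⟩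
      sgn (φ (d ∷ replicate m d ++ [ b ]) - φ (a ∷ d ∷ replicate m d))
    ≡⟨ cong (λ v → sgn (φ (d ∷ replicate m d ++ [ b ]) - φ (a ∷ v))) (replicate-∷ʳ m d) ⟩
      sgn (φ (d ∷ replicate m d ++ [ b ]) - φ (a ∷ replicate m d ++ [ d ]))
    ≡⟨ cong₂ (λ p q → sgn (p - q)) (φ-border-replicate d d m b) (φ-border-replicate a d m d) ⟩
      sgn (φ-aroundConstant d d (even m) b - φ-aroundConstant a d (even m) d)
    ≡⟨ φ-aroundConstant-rec a d b (even m) short ⟩
      φ-aroundConstant a d (even (suc m)) b
    ∎
    where open ≡-Reasoning

ξ-replicate : ∀ m d → ξ (replicate m d) ≡ 0ℤ
ξ-replicate zero          d = refl
ξ-replicate (suc zero)    𝟘 = refl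
ξ-replicate (suc zero)    𝟙 = refl
ξ-replicate (suc (suc m)) d =
  begin
    ξ (d ∷ d ∷ replicate m d)
  ≡⟨ ξ-rec-nonAlternating d (d ∷ replicate m d) (nonAlternating-twice d (replicate m d)) ⟩
    sgn (ξ (l (d ∷ d ∷ replicate m d)) + ξ (d ∷ replicate m d))
  ≡⟨ cong (λ v → sgn (ξ v + ξ (d ∷ replicate m d))) (l-replicate (suc m) d) ⟩
    sgn (ξ (replicate (suc m) d) + ξ (replicate (suc m) d))
  ≡⟨ cong (λ v → sgn (v + v)) (ξ-replicate (suc m) d) ⟩
    0ℤ
  ∎
  where open ≡-Reasoning

ξ-comp∷replicate : ∀ d m → ξ (comp d ∷ replicate (suc m) d) ≡ σ d
ξ-comp∷replicate 𝟘 zero    = refl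
ξ-comp∷replicate 𝟙 zero    = refl
ξ-comp∷replicate d (suc m) =
  begin
    ξ (comp d ∷ d ∷ d ∷ replicate m d)
  ≡⟨ ξ-rec-nonAlternating (comp d) (d ∷ d ∷ replicate m d)
       (nonAlternating-∷ (comp d) (d ∷ d ∷ replicate m d) (nonAlternating-twice d (replicate m d))) ⟩
    sgn (ξ (comp d ∷ l (d ∷ d ∷ replicate m d)) + ξ (d ∷ d ∷ replicate m d))
  ≡⟨ cong₂ (λ p q → sgn (ξ (comp d ∷ p) + q)) (l-replicate (suc m) d) (ξ-replicate (suc (suc m)) d) ⟩
    sgn (ξ (comp d ∷ replicate (suc m) d) + 0ℤ)
  ≡⟨ cong (λ v → sgn (v + 0ℤ)) (ξ-comp∷replicate d m) ⟩
    sgn (σ d + 0ℤ)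
  ≡⟨ sgn-σ+0 d ⟩
    σ d
  ∎
  where
  open ≡-Reasoning
  sgn-σ+0 : ∀ d → sgn (σ d + 0ℤ) ≡ σ d
  sgn-σ+0 𝟘 = refl
  sgn-σ+0 𝟙 = refl

ξ-replicate-∷ʳcomp : ∀ d m → ξ (replicate (suc m) d ++ [ comp d ]) ≡ σ (comp d)
ξ-replicate-∷ʳcomp 𝟘 zero    = refl
ξ-replicate-∷ʳcomp 𝟙 zero    = refl
ξ-replicate-∷ʳcomp d (suc m) =
  begin
    ξ (d ∷ d ∷ replicate m d ++ [ comp d ])
  ≡⟨ ξ-rec-nonAlternating d (d ∷ replicate m d ++ [ comp d ]) (nonAlternating-twice d (replicate m d ++ [ comp d ])) ⟩
    sgn (ξ (l (d ∷ d ∷ replicate m d ++ [ comp d ])) + ξ (d ∷ replicate m d ++ [ comp d ]))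
  ≡⟨ cong₂ (λ p q → sgn (ξ p + q)) (l-∷ʳ (d ∷ d ∷ replicate m d) (comp d)) (ξ-replicate-∷ʳcomp d m) ⟩
    sgn (ξ (replicate (suc (suc m)) d) + σ (comp d))
  ≡⟨ cong (λ v → sgn (v + σ (comp d))) (ξ-replicate (suc (suc m)) d) ⟩
    sgn (0ℤ + σ (comp d))
  ≡⟨ sgn-0+σ (comp d) ⟩
    σ (comp d)
  ∎
  where
  open ≡-Reasoning
  sgn-0+σ : ∀ d → sgn (0ℤ + σ d) ≡ σ d
  sgn-0+σ 𝟘 = refl
  sgn-0+σ 𝟙 = refl

slope-trans : ∀ a d b → sgn (slope a d + slope d b) ≡ slope a b
slope-trans 𝟘 𝟘 𝟘 = refl
slope-trans 𝟘 𝟘 𝟙 = refl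
slope-trans 𝟘 𝟙 𝟘 = refl
slope-trans 𝟘 𝟙 𝟙 = refl
slope-trans 𝟙 𝟘 𝟘 = refl
slope-trans 𝟙 𝟘 𝟙 = refl
slope-trans 𝟙 𝟙 𝟘 = refl
slope-trans 𝟙 𝟙 𝟙 = refl

ξ-pair : ∀ a b → ξ (a ∷ [ b ]) ≡ slope a b
ξ-pair 𝟘 𝟘 = refl
ξ-pair 𝟘 𝟙 = refl
ξ-pair 𝟙 𝟘 = refl
ξ-pair 𝟙 𝟙 = refl

ξ-border-replicate : ∀ a d m b → ξ (a ∷ replicate m d ++ [ b ]) ≡ slope a b
ξ-border-replicate a d zero b = ξ-pair a b
ξ-border-replicate a d (suc zero) b =
  trans (ξ-border a [ d ] b (odd⇒notEvenAlt (a ∷ d ∷ [ b ]) refl))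
        (trans (cong₂ (λ p q → sgn (p + q)) (ξ-pair a d) (ξ-pair d b)) (slope-trans a d b))
ξ-border-replicate a d (suc (suc m)) b =
  begin
    ξ (a ∷ (d ∷ d ∷ replicate m d) ++ [ b ])
  ≡⟨ ξ-border a (d ∷ d ∷ replicate m d) b
       (notEvenAlt-frame a (d ∷ d ∷ replicate m d) b (nonAlternating-twice d (replicate m d))) ⟩
    sgn (ξ (a ∷ d ∷ d ∷ replicate m d) + ξ (d ∷ d ∷ replicate m d ++ [ b ]))
  ≡⟨ cong (λ v → sgn (ξ (a ∷ d ∷ v) + ξ (d ∷ d ∷ replicate m d ++ [ b ]))) (replicate-∷ʳ m d) ⟩
    sgn (ξ (a ∷ replicate (suc m) d ++ [ d ]) + ξ (d ∷ replicate (suc m) d ++ [ b ]))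
  ≡⟨ cong₂ (λ p q → sgn (p + q)) (ξ-border-replicate a d (suc m) d) (ξ-border-replicate d d (suc m) b) ⟩
    sgn (slope a d + slope d b)
  ≡⟨ slope-trans a d b ⟩
    slope a b
  ∎
  where open ≡-Reasoning


-- ξ on alternating words

ξ-alt-even : ∀ x k → ξ (alt x (twice (suc k))) ≡ σ (comp x)
ξ-alt-even 𝟘 k rewrite ξ-∷ 𝟘 (alt 𝟙 (suc (twice k))) | evenAlt-alt 𝟘 k = refl
ξ-alt-even 𝟙 k rewrite ξ-∷ 𝟙 (alt 𝟘 (suc (twice k))) | evenAlt-alt 𝟙 k = refl

ξ-alt-odd : ∀ x k → ξ (alt x (suc (twice k))) ≡ 0ℤ
ξ-alt-odd 𝟘 zero    = refl
ξ-alt-odd 𝟙 zero    = refl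
ξ-alt-odd x (suc k) =
  begin
    ξ (alt x (suc (twice (suc k))))
  ≡⟨ ξ-rec x (alt (comp x) (twice (suc k))) (odd⇒notEvenAlt (alt x (suc (twice (suc k)))) (even-alt-odd x (suc k))) ⟩
    sgn (ξ (l (alt x (suc (twice (suc k))))) + ξ (alt (comp x) (twice (suc k))))
  ≡⟨ cong₂ (λ p q → sgn (ξ p + q)) (l-alt x (twice (suc k))) (ξ-alt-even (comp x) k) ⟩
    sgn (ξ (alt x (twice (suc k))) + σ (comp (comp x)))
  ≡⟨ cong (λ v → sgn (v + σ (comp (comp x)))) (ξ-alt-even x k) ⟩
    sgn (σ (comp x) + σ (comp (comp x)))
  ≡⟨ cancel x ⟩
    0ℤ
  ∎
  where
  open ≡-Reasoning
  cancel : ∀ x → sgn (σ (comp x) + σ (comp (comp x))) ≡ 0ℤ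
  cancel 𝟘 = refl
  cancel 𝟙 = refl

-- The framed word a ∷ alt x (twice (suc k)) ++ [ b ] is itself alternating exactly when
-- a = comp x and b = x.
ξ-aroundEvenAlt : Bit → Bit → Bit → ℤ
ξ-aroundEvenAlt a x b = σ (if (a ≡ᵇ comp x) ∧ (b ≡ᵇ x) then x else comp x)

ξ-aroundEvenAlt-rec : ∀ a x b → ((a ≡ᵇ comp x) ∧ (b ≡ᵇ x)) ≡ false →
  sgn (slope a (comp x) + slope x b) ≡ ξ-aroundEvenAlt a x b
ξ-aroundEvenAlt-rec 𝟘 𝟘 𝟘 _ = refl
ξ-aroundEvenAlt-rec 𝟘 𝟘 𝟙 _ = refl
ξ-aroundEvenAlt-rec 𝟘 𝟙 𝟘 _ = refl
ξ-aroundEvenAlt-rec 𝟙 𝟘 𝟙 _ = refl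
ξ-aroundEvenAlt-rec 𝟙 𝟙 𝟘 _ = refl
ξ-aroundEvenAlt-rec 𝟙 𝟙 𝟙 _ = refl

ξ-aroundEvenAlt-odd : ∀ a x b → sgn (ξ-aroundEvenAlt a x x + ξ-aroundEvenAlt x (comp x) b) ≡ slope a b
ξ-aroundEvenAlt-odd 𝟘 𝟘 𝟘 = refl
ξ-aroundEvenAlt-odd 𝟘 𝟘 𝟙 = refl
ξ-aroundEvenAlt-odd 𝟘 𝟙 𝟘 = refl
ξ-aroundEvenAlt-odd 𝟘 𝟙 𝟙 = refl
ξ-aroundEvenAlt-odd 𝟙 𝟘 𝟘 = refl
ξ-aroundEvenAlt-odd 𝟙 𝟘 𝟙 = refl
ξ-aroundEvenAlt-odd 𝟙 𝟙 𝟘 = refl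
ξ-aroundEvenAlt-odd 𝟙 𝟙 𝟙 = refl

mutual
  ξ-border-alt-odd : ∀ a x k b → ξ (a ∷ alt x (suc (twice k)) ++ [ b ]) ≡ slope a b
  ξ-border-alt-odd a x zero    b = ξ-border-replicate a x 1 b
  ξ-border-alt-odd a x (suc k) b =
    begin
      ξ (a ∷ alt x (suc (twice (suc k))) ++ [ b ])
    ≡⟨ ξ-border a (alt x (suc (twice (suc k)))) b
         (odd⇒notEvenAlt (a ∷ alt x (suc (twice (suc k))) ++ [ b ]) (even-frame-alt-odd a x (suc k) b)) ⟩
      sgn (ξ (a ∷ alt x (suc (twice (suc k)))) + ξ (x ∷ alt (comp x) (twice (suc k)) ++ [ b ]))
    ≡⟨ cong (λ v → sgn (ξ (a ∷ v) + ξ (x ∷ alt (comp x) (twice (suc k)) ++ [ b ]))) (alt-odd-∷ʳ x (suc k)) ⟩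
      sgn (ξ (a ∷ alt x (twice (suc k)) ++ [ x ]) + ξ (x ∷ alt (comp x) (twice (suc k)) ++ [ b ]))
    ≡⟨ cong₂ (λ p q → sgn (p + q)) (ξ-border-alt-even a x k x) (ξ-border-alt-even x (comp x) k b) ⟩
      sgn (ξ-aroundEvenAlt a x x + ξ-aroundEvenAlt x (comp x) b)
    ≡⟨ ξ-aroundEvenAlt-odd a x b ⟩
      slope a b
    ∎
    where open ≡-Reasoning

  ξ-border-alt-even : ∀ a x k b → ξ (a ∷ alt x (twice (suc k)) ++ [ b ]) ≡ ξ-aroundEvenAlt a x b
  ξ-border-alt-even 𝟙 𝟘 k 𝟘 = trans (cong (λ v → ξ (𝟙 ∷ v)) (sym (alt-odd-∷ʳ 𝟘 (suc k)))) (ξ-alt-even 𝟙 (suc k))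
  ξ-border-alt-even 𝟘 𝟙 k 𝟙 = trans (cong (λ v → ξ (𝟘 ∷ v)) (sym (alt-odd-∷ʳ 𝟙 (suc k)))) (ξ-alt-even 𝟘 (suc k))
  ξ-border-alt-even 𝟘 𝟘 k b = ξ-border-alt-even-rec 𝟘 𝟘 k b refl (nonAlternating-twice 𝟘 (alt 𝟙 (suc (twice k)) ++ [ b ]))
  ξ-border-alt-even 𝟙 𝟙 k b = ξ-border-alt-even-rec 𝟙 𝟙 k b refl (nonAlternating-twice 𝟙 (alt 𝟘 (suc (twice k)) ++ [ b ]))
  ξ-border-alt-even 𝟙 𝟘 k 𝟙 =
    ξ-border-alt-even-rec 𝟙 𝟘 k 𝟙 refl (nonAlternating-∷ 𝟙 (alt 𝟘 (twice (suc k)) ++ [ 𝟙 ]) (nonAlternating-alt-even-∷ʳ 𝟘 k))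
  ξ-border-alt-even 𝟘 𝟙 k 𝟘 =
    ξ-border-alt-even-rec 𝟘 𝟙 k 𝟘 refl (nonAlternating-∷ 𝟘 (alt 𝟙 (twice (suc k)) ++ [ 𝟘 ]) (nonAlternating-alt-even-∷ʳ 𝟙 k))

  ξ-border-alt-even-rec : ∀ a x k b → ((a ≡ᵇ comp x) ∧ (b ≡ᵇ x)) ≡ false →
    NonAlternating (a ∷ alt x (twice (suc k)) ++ [ b ]) →
    ξ (a ∷ alt x (twice (suc k)) ++ [ b ]) ≡ ξ-aroundEvenAlt a x b
  ξ-border-alt-even-rec a x k b unaligned h =
    begin
      ξ (a ∷ alt x (twice (suc k)) ++ [ b ])
    ≡⟨ ξ-border a (alt x (twice (suc k))) b (nonAlternating⇒notEvenAlt (a ∷ alt x (twice (suc k)) ++ [ b ]) h) ⟩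
      sgn (ξ (a ∷ alt x (twice (suc k))) + ξ (x ∷ alt (comp x) (suc (twice k)) ++ [ b ]))
    ≡⟨ cong (λ v → sgn (ξ (a ∷ v) + ξ (x ∷ alt (comp x) (suc (twice k)) ++ [ b ]))) (alt-even-∷ʳ x k) ⟩
      sgn (ξ (a ∷ alt x (suc (twice k)) ++ [ comp x ]) + ξ (x ∷ alt (comp x) (suc (twice k)) ++ [ b ]))
    ≡⟨ cong₂ (λ p q → sgn (p + q)) (ξ-border-alt-odd a x k (comp x)) (ξ-border-alt-odd x (comp x) k b) ⟩
      sgn (slope a (comp x) + slope x b)
    ≡⟨ ξ-aroundEvenAlt-rec a x b unaligned ⟩
      ξ-aroundEvenAlt a x b
    ∎
    where open ≡-Reasoning

Compatible : Bit → ℤ → Set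
Compatible x v = v ≡ 0ℤ ⊎ v ≡ σ x

absorbˡ : ∀ x {v} → Compatible x v → sgn (σ x + v) ≡ σ x
absorbˡ 𝟘 (inj₁ refl) = refl
absorbˡ 𝟘 (inj₂ refl) = refl
absorbˡ 𝟙 (inj₁ refl) = refl
absorbˡ 𝟙 (inj₂ refl) = refl

absorbʳ : ∀ x {v} → Compatible x v → sgn (v + σ x) ≡ σ x
absorbʳ 𝟘 (inj₁ refl) = refl
absorbʳ 𝟘 (inj₂ refl) = refl
absorbʳ 𝟙 (inj₁ refl) = refl
absorbʳ 𝟙 (inj₂ refl) = refl

slope-compatibleʳ : ∀ a b → Compatible b (slope a b)
slope-compatibleʳ 𝟘 𝟘 = inj₁ refl
slope-compatibleʳ 𝟘 𝟙 = inj₂ refl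
slope-compatibleʳ 𝟙 𝟘 = inj₂ refl
slope-compatibleʳ 𝟙 𝟙 = inj₁ refl

slope-compatibleˡ : ∀ a b → Compatible (comp a) (slope a b)
slope-compatibleˡ 𝟘 𝟘 = inj₁ refl
slope-compatibleˡ 𝟘 𝟙 = inj₂ refl
slope-compatibleˡ 𝟙 𝟘 = inj₂ refl
slope-compatibleˡ 𝟙 𝟙 = inj₁ refl

slope-comp-compatible : ∀ d b → Compatible d (slope (comp d) b)
slope-comp-compatible 𝟘 𝟘 = inj₂ refl
slope-comp-compatible 𝟘 𝟙 = inj₁ refl
slope-comp-compatible 𝟙 𝟘 = inj₁ refl
slope-comp-compatible 𝟙 𝟙 = inj₂ refl

ξ-alt-compatible : ∀ x n → Compatible (comp x) (ξ (alt x n))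
ξ-alt-compatible x n with parity n
... | is-twice zero     = inj₁ refl
... | is-twice (suc k)  = inj₂ (ξ-alt-even x k)
... | is-suc-twice k    = inj₁ (ξ-alt-odd x k)

ξ-border-alt-compatible : ∀ x n b → Compatible (comp x) (ξ (x ∷ alt x n ++ [ b ]))
ξ-border-alt-compatible x n b with parity n
... | is-twice zero     = subst (Compatible (comp x)) (sym (ξ-pair x b)) (slope-compatibleˡ x b)
... | is-twice (suc k)  = inj₂ (trans (ξ-border-alt-even x x k b) (not-flanked x b))
  where
  not-flanked : ∀ x b → ξ-aroundEvenAlt x x b ≡ σ (comp x)
  not-flanked 𝟘 b = refl
  not-flanked 𝟙 b = refl
... | is-suc-twice k    = subst (Compatible (comp x)) (sym (ξ-border-alt-odd x x k b)) (slope-compatibleˡ x b)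

ξ-doubled-head : ∀ x n → ξ (x ∷ alt x (suc (suc n))) ≡ σ (comp x)
ξ-doubled-head 𝟘 zero    = refl
ξ-doubled-head 𝟙 zero    = refl
ξ-doubled-head x (suc n) =
  begin
    ξ (x ∷ alt x (suc (suc (suc n))))
  ≡⟨ ξ-rec-nonAlternating x (alt x (suc (suc (suc n)))) (nonAlternating-twice x (alt (comp x) (suc (suc n)))) ⟩
    sgn (ξ (x ∷ l (alt x (suc (suc (suc n))))) + ξ (alt x (suc (suc (suc n)))))
  ≡⟨ cong (λ v → sgn (ξ (x ∷ v) + ξ (alt x (suc (suc (suc n)))))) (l-alt x (suc (suc n))) ⟩
    sgn (ξ (x ∷ alt x (suc (suc n))) + ξ (alt x (suc (suc (suc n)))))
  ≡⟨ cong (λ v → sgn (v + ξ (alt x (suc (suc (suc n)))))) (ξ-doubled-head x n) ⟩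
    sgn (σ (comp x) + ξ (alt x (suc (suc (suc n)))))
  ≡⟨ absorbˡ (comp x) (ξ-alt-compatible x (suc (suc (suc n)))) ⟩
    σ (comp x)
  ∎
  where open ≡-Reasoning

mutual
  ξ-alt-even-doubled-last : ∀ x k → ξ (alt x (twice (suc k)) ++ [ comp x ]) ≡ σ (comp x)
  ξ-alt-even-doubled-last 𝟘 zero    = refl
  ξ-alt-even-doubled-last 𝟙 zero    = refl
  ξ-alt-even-doubled-last x (suc k) =
    begin
      ξ (x ∷ alt (comp x) (suc (twice (suc k))) ++ [ comp x ])
    ≡⟨ ξ-rec-nonAlternating x (alt (comp x) (suc (twice (suc k))) ++ [ comp x ]) (nonAlternating-alt-even-∷ʳ x (suc k)) ⟩
      sgn (ξ (l (alt x (twice (suc (suc k))) ++ [ comp x ])) + ξ (alt (comp x) (suc (twice (suc k))) ++ [ comp x ]))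
    ≡⟨ cong₂ (λ p q → sgn (ξ p + q)) (l-∷ʳ (alt x (twice (suc (suc k)))) (comp x)) (ξ-alt-odd-doubled-last (comp x) k) ⟩
      sgn (ξ (alt x (twice (suc (suc k)))) + σ (comp x))
    ≡⟨ cong (λ v → sgn (v + σ (comp x))) (ξ-alt-even x (suc k)) ⟩
      sgn (σ (comp x) + σ (comp x))
    ≡⟨ absorbʳ (comp x) (inj₂ refl) ⟩
      σ (comp x)
    ∎
    where open ≡-Reasoning

  ξ-alt-odd-doubled-last : ∀ x k → ξ (alt x (suc (twice (suc k))) ++ [ x ]) ≡ σ x
  ξ-alt-odd-doubled-last x k =
    begin
      ξ (x ∷ alt (comp x) (twice (suc k)) ++ [ x ])
    ≡⟨ ξ-rec-nonAlternating x (alt (comp x) (twice (suc k)) ++ [ x ]) (nonAlternating-alt-odd-∷ʳ x (suc k)) ⟩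
      sgn (ξ (l (alt x (suc (twice (suc k))) ++ [ x ])) + ξ (alt (comp x) (twice (suc k)) ++ [ x ]))
    ≡⟨ cong₂ (λ p q → sgn (ξ p + q)) (l-∷ʳ (alt x (suc (twice (suc k)))) x) (ξ-comp-alt-even-doubled-last x k) ⟩
      sgn (ξ (alt x (suc (twice (suc k)))) + σ x)
    ≡⟨ cong (λ v → sgn (v + σ x)) (ξ-alt-odd x (suc k)) ⟩
      sgn (0ℤ + σ x)
    ≡⟨ absorbʳ x (inj₁ refl) ⟩
      σ x
    ∎
    where open ≡-Reasoning

  ξ-comp-alt-even-doubled-last : ∀ x k → ξ (alt (comp x) (twice (suc k)) ++ [ x ]) ≡ σ x
  ξ-comp-alt-even-doubled-last x k =
    subst (λ z → ξ (alt (comp x) (twice (suc k)) ++ [ z ]) ≡ σ z) (comp-involutive x) (ξ-alt-even-doubled-last (comp x) k)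


-- Framing a word

ξ-BorderStable : Str → Set
ξ-BorderStable u = ∀ a b → ξ (a ∷ u ++ [ b ]) ≡ ξ u

φ-BorderFlips : Str → Set
φ-BorderFlips u = ∀ a b → φ (a ∷ u ++ [ b ]) ≡ - φ u

ξ-border-step : ∀ a u b {X Y} → NonAlternating u → ξ (a ∷ u) ≡ X → ξ (u ++ [ b ]) ≡ Y → sgn (X + Y) ≡ ξ u →
  ξ (a ∷ u ++ [ b ]) ≡ ξ u
ξ-border-step a u b h left right sum =
  trans (ξ-border a u b (notEvenAlt-frame a u b h)) (trans (cong₂ (λ p q → sgn (p + q)) left right) sum)

φ-border-step : ∀ a u b {X Y} → NonConstant u → φ (a ∷ u) ≡ X → φ (u ++ [ b ]) ≡ Y → sgn (Y - X) ≡ - φ u →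
  φ (a ∷ u ++ [ b ]) ≡ - φ u
φ-border-step a u b h left right diff =
  trans (φ-border a u b (nonConstant-border a u b h)) (trans (cong₂ (λ p q → sgn (q - p)) left right) diff)

ξ-border-comp∷replicate : ∀ d k → ξ-BorderStable (comp d ∷ replicate (suc (suc k)) d)
ξ-border-comp∷replicate 𝟘 zero = all-pairs refl refl refl refl
ξ-border-comp∷replicate 𝟙 zero = all-pairs refl refl refl refl
ξ-border-comp∷replicate d (suc k) a b =
  ξ-border-step a u b (nonAlternating-∷ (comp d) (replicate (suc (suc (suc k))) d) (nonAlternating-twice d (replicate (suc k) d)))
    (trans (cong (λ v → ξ (a ∷ comp d ∷ v)) (replicate-∷ʳ (suc (suc k)) d))
           (trans (ξ-border-comp∷replicate d k a d) (ξ-comp∷replicate d (suc k))))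
    (ξ-border-replicate (comp d) d (suc (suc (suc k))) b)
    (trans (absorbˡ d (slope-comp-compatible d b)) (sym (ξ-comp∷replicate d (suc (suc k)))))
  where
  u : Str
  u = comp d ∷ replicate (suc (suc (suc k))) d

ξ-border-replicate-∷ʳcomp : ∀ d k → ξ-BorderStable (replicate (suc (suc k)) d ++ [ comp d ])
ξ-border-replicate-∷ʳcomp 𝟘 zero = all-pairs refl refl refl refl
ξ-border-replicate-∷ʳcomp 𝟙 zero = all-pairs refl refl refl refl
ξ-border-replicate-∷ʳcomp d (suc k) a b =
  ξ-border-step a u b (nonAlternating-twice d (replicate (suc k) d ++ [ comp d ]))
    (ξ-border-replicate a d (suc (suc (suc k))) (comp d))
    (trans (ξ-border-replicate-∷ʳcomp d k d b) (ξ-replicate-∷ʳcomp d (suc k)))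
    (trans (absorbʳ (comp d) (slope-compatibleʳ a (comp d))) (sym (ξ-replicate-∷ʳcomp d (suc (suc k)))))
  where
  u : Str
  u = replicate (suc (suc (suc k))) d ++ [ comp d ]

ξ-border-doubled-head : ∀ x k → ξ-BorderStable (x ∷ alt x (suc (suc k)))
ξ-border-doubled-head 𝟘 zero = all-pairs refl refl refl refl
ξ-border-doubled-head 𝟙 zero = all-pairs refl refl refl refl
ξ-border-doubled-head x (suc k) a b =
  ξ-border-step a u b (nonAlternating-twice x (alt (comp x) (suc (suc k))))
    (trans (cong (λ v → ξ (a ∷ x ∷ v)) (alt-∷ʳ x (suc (suc k))))
           (trans (ξ-border-doubled-head x k a _) (ξ-doubled-head x k)))
    refl
    (trans (absorbˡ (comp x) (ξ-border-alt-compatible x (suc (suc (suc k))) b)) (sym (ξ-doubled-head x (suc k))))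
  where
  u : Str
  u = x ∷ alt x (suc (suc (suc k)))

ξ-aroundEvenAlt-comp : ∀ a x → ξ-aroundEvenAlt a x (comp x) ≡ σ (comp x)
ξ-aroundEvenAlt-comp 𝟘 𝟘 = refl
ξ-aroundEvenAlt-comp 𝟘 𝟙 = refl
ξ-aroundEvenAlt-comp 𝟙 𝟘 = refl
ξ-aroundEvenAlt-comp 𝟙 𝟙 = refl

mutual
  ξ-border-alt-even-doubled-last : ∀ x k → ξ-BorderStable (alt x (twice (suc k)) ++ [ comp x ])
  ξ-border-alt-even-doubled-last 𝟘 zero = all-pairs refl refl refl refl
  ξ-border-alt-even-doubled-last 𝟙 zero = all-pairs refl refl refl refl
  ξ-border-alt-even-doubled-last x (suc k) a b =
    ξ-border-step a u b (nonAlternating-alt-even-∷ʳ x (suc k))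
      (trans (ξ-border-alt-even a x (suc k) (comp x)) (ξ-aroundEvenAlt-comp a x))
      (trans (ξ-border-alt-odd-doubled-last (comp x) k x b) (ξ-alt-odd-doubled-last (comp x) k))
      (trans (absorbʳ (comp x) (inj₂ refl)) (sym (ξ-alt-even-doubled-last x (suc k))))
    where
    u : Str
    u = alt x (twice (suc (suc k))) ++ [ comp x ]

  ξ-border-alt-odd-doubled-last : ∀ x k → ξ-BorderStable (alt x (suc (twice (suc k))) ++ [ x ])
  ξ-border-alt-odd-doubled-last 𝟘 zero = all-pairs refl refl refl refl
  ξ-border-alt-odd-doubled-last 𝟙 zero = all-pairs refl refl refl refl
  ξ-border-alt-odd-doubled-last x (suc k) a b =
    ξ-border-step a u b (nonAlternating-alt-odd-∷ʳ x (suc (suc k)))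
      (ξ-border-alt-odd a x (suc (suc k)) x)
      (trans (ξ-border-comp-alt-even-doubled-last x (suc k) x b) (ξ-comp-alt-even-doubled-last x (suc k)))
      (trans (absorbʳ x (slope-compatibleʳ a x)) (sym (ξ-alt-odd-doubled-last x (suc k))))
    where
    u : Str
    u = alt x (suc (twice (suc (suc k)))) ++ [ x ]

  ξ-border-comp-alt-even-doubled-last : ∀ x k → ξ-BorderStable (alt (comp x) (twice (suc k)) ++ [ x ])
  ξ-border-comp-alt-even-doubled-last x k =
    subst (λ z → ξ-BorderStable (alt (comp x) (twice (suc k)) ++ [ z ])) (comp-involutive x) (ξ-border-alt-even-doubled-last (comp x) k)

φ-border-comp∷replicate : ∀ d k → φ-BorderFlips (comp d ∷ replicate (suc k) d)
φ-border-comp∷replicate 𝟘 zero = all-pairs refl refl refl refl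
φ-border-comp∷replicate 𝟙 zero = all-pairs refl refl refl refl
φ-border-comp∷replicate d (suc k) a b =
  φ-border-step a u b (nonConstant-comp∷ d (replicate (suc k) d))
    (trans (cong (λ v → φ (a ∷ comp d ∷ v)) (replicate-∷ʳ (suc k) d))
           (trans (φ-border-comp∷replicate d k a d) (cong -_ (φ-comp∷replicate d (suc k)))))
    (φ-border-replicate (comp d) d (suc (suc k)) b)
    (trans (table d b (even (suc k))) (cong -_ (sym (φ-comp∷replicate d (suc (suc k))))))
  where
  u : Str
  u = comp d ∷ replicate (suc (suc k)) d
  table : ∀ d b e → sgn (φ-aroundConstant (comp d) d (if e then false else true) b - - (if e then σ (comp d) else σ d))
                  ≡ - (if (if e then false else true) then σ (comp d) else σ d)
  table 𝟘 𝟘 true  = refl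
  table 𝟘 𝟘 false = refl
  table 𝟘 𝟙 true  = refl
  table 𝟘 𝟙 false = refl
  table 𝟙 𝟘 true  = refl
  table 𝟙 𝟘 false = refl
  table 𝟙 𝟙 true  = refl
  table 𝟙 𝟙 false = refl

φ-border-replicate-∷ʳcomp : ∀ d k → φ-BorderFlips (replicate (suc k) d ++ [ comp d ])
φ-border-replicate-∷ʳcomp 𝟘 zero = all-pairs refl refl refl refl
φ-border-replicate-∷ʳcomp 𝟙 zero = all-pairs refl refl refl refl
φ-border-replicate-∷ʳcomp d (suc k) a b =
  φ-border-step a u b (nonConstant-∷ʳ-comp d (replicate (suc k) d))
    (φ-border-replicate a d (suc (suc k)) (comp d))
    (trans (φ-border-replicate-∷ʳcomp d k d b) (cong -_ (φ-replicate-∷ʳcomp d (suc k))))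
    (trans (table a d (even (suc (suc k)))) (cong -_ (sym (φ-replicate-∷ʳcomp d (suc (suc k))))))
  where
  u : Str
  u = replicate (suc (suc k)) d ++ [ comp d ]
  table : ∀ a d e → sgn (- σ (comp d) - φ-aroundConstant a d e (comp d)) ≡ - σ (comp d)
  table 𝟘 𝟘 true  = refl
  table 𝟘 𝟘 false = refl
  table 𝟘 𝟙 true  = refl
  table 𝟘 𝟙 false = refl
  table 𝟙 𝟘 true  = refl
  table 𝟙 𝟘 false = refl
  table 𝟙 𝟙 true  = refl
  table 𝟙 𝟙 false = refl

ξ-StableIfIrregular : Str → Set
ξ-StableIfIrregular u = NonConstant u → NonAlternating u → ξ-BorderStable u

ξ-stable-constant-tail : ∀ x d m → ξ-StableIfIrregular (x ∷ replicate m d)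
ξ-stable-constant-tail x d zero          nc na = ⊥-elim (¬nonConstant-replicate 1 x nc)
ξ-stable-constant-tail 𝟘 𝟘 m             nc na = ⊥-elim (¬nonConstant-replicate (suc m) 𝟘 nc)
ξ-stable-constant-tail 𝟙 𝟙 m             nc na = ⊥-elim (¬nonConstant-replicate (suc m) 𝟙 nc)
ξ-stable-constant-tail 𝟘 𝟙 (suc zero)    nc na = ⊥-elim (¬nonAlternating-alt 𝟘 2 na)
ξ-stable-constant-tail 𝟙 𝟘 (suc zero)    nc na = ⊥-elim (¬nonAlternating-alt 𝟙 2 na)
ξ-stable-constant-tail 𝟘 𝟙 (suc (suc k)) _  _  = ξ-border-comp∷replicate 𝟙 k
ξ-stable-constant-tail 𝟙 𝟘 (suc (suc k)) _  _  = ξ-border-comp∷replicate 𝟘 k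

ξ-stable-alternating-tail : ∀ x y m → ξ-StableIfIrregular (x ∷ alt y m)
ξ-stable-alternating-tail x y zero          nc na = ⊥-elim (¬nonConstant-replicate 1 x nc)
ξ-stable-alternating-tail 𝟘 𝟙 m             nc na = ⊥-elim (¬nonAlternating-alt 𝟘 (suc m) na)
ξ-stable-alternating-tail 𝟙 𝟘 m             nc na = ⊥-elim (¬nonAlternating-alt 𝟙 (suc m) na)
ξ-stable-alternating-tail 𝟘 𝟘 (suc zero)    nc na = ⊥-elim (¬nonConstant-replicate 2 𝟘 nc)
ξ-stable-alternating-tail 𝟙 𝟙 (suc zero)    nc na = ⊥-elim (¬nonConstant-replicate 2 𝟙 nc)
ξ-stable-alternating-tail 𝟘 𝟘 (suc (suc k)) _  _  = ξ-border-doubled-head 𝟘 k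
ξ-stable-alternating-tail 𝟙 𝟙 (suc (suc k)) _  _  = ξ-border-doubled-head 𝟙 k

ξ-stable-constant-init : ∀ d m z → ξ-StableIfIrregular (replicate m d ++ [ z ])
ξ-stable-constant-init d zero          z nc na = ⊥-elim (¬nonConstant-replicate 1 z nc)
ξ-stable-constant-init 𝟘 m             𝟘 nc na = ⊥-elim (¬nonConstant-replicate-∷ʳ m 𝟘 nc)
ξ-stable-constant-init 𝟙 m             𝟙 nc na = ⊥-elim (¬nonConstant-replicate-∷ʳ m 𝟙 nc)
ξ-stable-constant-init 𝟘 (suc zero)    𝟙 nc na = ⊥-elim (¬nonAlternating-alt 𝟘 2 na)
ξ-stable-constant-init 𝟙 (suc zero)    𝟘 nc na = ⊥-elim (¬nonAlternating-alt 𝟙 2 na)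
ξ-stable-constant-init 𝟘 (suc (suc k)) 𝟙 _  _  = ξ-border-replicate-∷ʳcomp 𝟘 k
ξ-stable-constant-init 𝟙 (suc (suc k)) 𝟘 _  _  = ξ-border-replicate-∷ʳcomp 𝟙 k

ξ-stable-alt-∷ʳ-repeat : ∀ x m → ξ-StableIfIrregular (alt x m ++ [ x ])
ξ-stable-alt-∷ʳ-repeat x m with parity m
... | is-twice zero           = λ nc na → ⊥-elim (¬nonConstant-replicate 1 x nc)
... | is-twice (suc k)        = λ nc na →
  ⊥-elim (¬nonAlternating-alt x (suc (twice (suc k))) (subst NonAlternating (sym (alt-odd-∷ʳ x (suc k))) na))
... | is-suc-twice zero       = λ nc na → ⊥-elim (¬nonConstant-replicate 2 x nc)
... | is-suc-twice (suc k)    = λ _ _ → ξ-border-alt-odd-doubled-last x k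

ξ-stable-alt-∷ʳ-comp : ∀ x m → ξ-StableIfIrregular (alt x m ++ [ comp x ])
ξ-stable-alt-∷ʳ-comp x m with parity m
... | is-twice zero           = λ nc na → ⊥-elim (¬nonConstant-replicate 1 (comp x) nc)
... | is-twice (suc k)        = λ _ _ → ξ-border-alt-even-doubled-last x k
... | is-suc-twice k          = λ nc na →
  ⊥-elim (¬nonAlternating-alt x (twice (suc k)) (subst NonAlternating (sym (alt-even-∷ʳ x k)) na))

ξ-stable-alternating-init : ∀ x m z → ξ-StableIfIrregular (alt x m ++ [ z ])
ξ-stable-alternating-init 𝟘 m 𝟘 = ξ-stable-alt-∷ʳ-repeat 𝟘 m
ξ-stable-alternating-init 𝟙 m 𝟙 = ξ-stable-alt-∷ʳ-repeat 𝟙 m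
ξ-stable-alternating-init 𝟘 m 𝟙 = ξ-stable-alt-∷ʳ-comp 𝟘 m
ξ-stable-alternating-init 𝟙 m 𝟘 = ξ-stable-alt-∷ʳ-comp 𝟙 m

ξ-border-irregular : ∀ u → ξ-StableIfIrregular u
ξ-border-irregular u = go (length u) u refl
  where
  go : ∀ n u → length u ≡ n → ξ-StableIfIrregular u
  go zero    []      _  nc = ⊥-elim (true≢false (nc 𝟘))
  go (suc n) u       len with initLast u
  ... | []             = λ nc → ⊥-elim (true≢false (nc 𝟘))
  ... | [] ∷ʳ′ z       = λ nc → ⊥-elim (¬nonConstant-replicate 1 z nc)
  ... | (x ∷ w) ∷ʳ′ z  with shape (w ++ [ z ]) | shape (x ∷ w)
  ...   | constant d eq    | _ =
    subst (λ v → ξ-StableIfIrregular (x ∷ v)) (sym eq) (ξ-stable-constant-tail x d (length (w ++ [ z ])))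
  ...   | alternating y eq | _ =
    subst (λ v → ξ-StableIfIrregular (x ∷ v)) (sym eq) (ξ-stable-alternating-tail x y (length (w ++ [ z ])))
  ...   | irregular _ _ | constant d eq =
    subst (λ v → ξ-StableIfIrregular (v ++ [ z ])) (sym eq) (ξ-stable-constant-init d (length (x ∷ w)) z)
  ...   | irregular _ _ | alternating y eq =
    subst (λ v → ξ-StableIfIrregular (v ++ [ z ])) (sym eq) (ξ-stable-alternating-init y (length (x ∷ w)) z)
  ...   | irregular ncʳ naʳ | irregular ncˡ naˡ = λ nc na a b →
    ξ-border-step a (x ∷ w ++ [ z ]) b na (go n (x ∷ w) lenˡ ncˡ naˡ a z) (go n (w ++ [ z ]) lenʳ ncʳ naʳ x b)
      (sym (trans (ξ-rec-nonAlternating x (w ++ [ z ]) na) (cong (λ v → sgn (ξ v + ξ (w ++ [ z ]))) (l-∷ʳ (x ∷ w) z))))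
    where
    lenʳ : length (w ++ [ z ]) ≡ n
    lenʳ = suc-injective len
    lenˡ : length (x ∷ w) ≡ n
    lenˡ = trans (sym (length-∷ʳ w z)) lenʳ

sgn-neg : ∀ z → sgn (- z) ≡ - sgn z
sgn-neg (+ zero)  = refl
sgn-neg (+ suc _) = refl
sgn-neg -[1+ _ ]  = refl

sgn-neg-diff : ∀ p q → sgn (- p - - q) ≡ - sgn (p - q)
sgn-neg-diff p q = trans (cong sgn (sym (neg-distrib-+ p (- q)))) (sgn-neg (p - q))

φ-FlipsIfNonConstant : Str → Set
φ-FlipsIfNonConstant u = NonConstant u → φ-BorderFlips u

φ-flips-constant-tail : ∀ x d m → φ-FlipsIfNonConstant (x ∷ replicate m d)
φ-flips-constant-tail x d zero    nc = ⊥-elim (¬nonConstant-replicate 1 x nc)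
φ-flips-constant-tail 𝟘 𝟘 m       nc = ⊥-elim (¬nonConstant-replicate (suc m) 𝟘 nc)
φ-flips-constant-tail 𝟙 𝟙 m       nc = ⊥-elim (¬nonConstant-replicate (suc m) 𝟙 nc)
φ-flips-constant-tail 𝟘 𝟙 (suc k) _  = φ-border-comp∷replicate 𝟙 k
φ-flips-constant-tail 𝟙 𝟘 (suc k) _  = φ-border-comp∷replicate 𝟘 k

φ-flips-constant-init : ∀ d m z → φ-FlipsIfNonConstant (replicate m d ++ [ z ])
φ-flips-constant-init d zero    z nc = ⊥-elim (¬nonConstant-replicate 1 z nc)
φ-flips-constant-init 𝟘 m       𝟘 nc = ⊥-elim (¬nonConstant-replicate-∷ʳ m 𝟘 nc)
φ-flips-constant-init 𝟙 m       𝟙 nc = ⊥-elim (¬nonConstant-replicate-∷ʳ m 𝟙 nc)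
φ-flips-constant-init 𝟘 (suc k) 𝟙 _  = φ-border-replicate-∷ʳcomp 𝟘 k
φ-flips-constant-init 𝟙 (suc k) 𝟘 _  = φ-border-replicate-∷ʳcomp 𝟙 k

φ-border-nonConstant : ∀ u → φ-FlipsIfNonConstant u
φ-border-nonConstant u = go (length u) u refl
  where
  go : ∀ n u → length u ≡ n → φ-FlipsIfNonConstant u
  go zero    []      _  nc = ⊥-elim (true≢false (nc 𝟘))
  go (suc n) u       len with initLast u
  ... | []             = λ nc → ⊥-elim (true≢false (nc 𝟘))
  ... | [] ∷ʳ′ z       = λ nc → ⊥-elim (¬nonConstant-replicate 1 z nc)
  ... | (x ∷ w) ∷ʳ′ z  with constancy (w ++ [ z ]) | constancy (x ∷ w)
  ...   | constant d eq | _ =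
    subst (λ v → φ-FlipsIfNonConstant (x ∷ v)) (sym eq) (φ-flips-constant-tail x d (length (w ++ [ z ])))
  ...   | nonConstant _ | constant d eq =
    subst (λ v → φ-FlipsIfNonConstant (v ++ [ z ])) (sym eq) (φ-flips-constant-init d (length (x ∷ w)) z)
  ...   | nonConstant ncʳ | nonConstant ncˡ = λ nc a b →
    φ-border-step a (x ∷ w ++ [ z ]) b nc (go n (x ∷ w) lenˡ ncˡ a z) (go n (w ++ [ z ]) lenʳ ncʳ x b)
      (trans (sgn-neg-diff (φ (w ++ [ z ])) (φ (x ∷ w)))
             (cong -_ (sym (trans (φ-rec x (w ++ [ z ]) nc) (cong (λ v → sgn (φ (w ++ [ z ]) - φ v)) (l-∷ʳ (x ∷ w) z))))))
    where
    lenʳ : length (w ++ [ z ]) ≡ n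
    lenʳ = suc-injective len
    lenˡ : length (x ∷ w) ≡ n
    lenˡ = trans (sym (length-∷ʳ w z)) lenʳ


-- ψ of a framed word

σ-power-twice : ∀ y k → σ y ^ twice k ≡ 1ℤ
σ-power-twice y zero    = refl
σ-power-twice 𝟘 (suc k) rewrite σ-power-twice 𝟘 k = refl
σ-power-twice 𝟙 (suc k) rewrite σ-power-twice 𝟙 k = refl

Sloped : Str → Set
Sloped u = ∀ a b → ξ (a ∷ u ++ [ b ]) ≡ slope a b

data BorderBehaviour (u : Str) : Set where
  sloped      : Sloped u → BorderBehaviour u
  ψ-invariant : ∀ v → (∀ a b → ψ (a ∷ u ++ [ b ]) ≡ v) → BorderBehaviour u

ψ-border-alt-even : ∀ a x k b → ψ (a ∷ alt x (twice (suc k)) ++ [ b ]) ≡ - φ (alt x (twice (suc k)))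
ψ-border-alt-even a x k b =
  begin
    ξ w ^ length w * φ w
  ≡⟨ cong₂ _*_ (cong₂ _^_ (ξ-border-alt-even a x k b) length-w) (φ-border-nonConstant u (nonConstant-alt x (twice k)) a b) ⟩
    ξ-aroundEvenAlt a x b ^ twice (suc (suc k)) * - φ u
  ≡⟨ cong (_* - φ u) (σ-power-twice (if (a ≡ᵇ comp x) ∧ (b ≡ᵇ x) then x else comp x) (suc (suc k))) ⟩
    1ℤ * - φ u
  ≡⟨ *-identityˡ (- φ u) ⟩
    - φ u
  ∎
  where
  open ≡-Reasoning
  u w : Str
  u = alt x (twice (suc k))
  w = a ∷ u ++ [ b ]
  length-w : length w ≡ twice (suc (suc k))
  length-w = trans (length-frame a u b) (cong (λ n → suc (suc n)) (length-alt x (twice (suc k))))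

borderBehaviour-alt : ∀ x n → BorderBehaviour (alt x n)
borderBehaviour-alt x n with parity n
... | is-twice zero    = sloped ξ-pair
... | is-twice (suc k) = ψ-invariant (- φ (alt x (twice (suc k)))) (λ a b → ψ-border-alt-even a x k b)
... | is-suc-twice k   = sloped (λ a b → ξ-border-alt-odd a x k b)

borderBehaviour : ∀ u → BorderBehaviour u
borderBehaviour u with shape u
... | constant d eq    = subst BorderBehaviour (sym eq) (sloped (λ a b → ξ-border-replicate a d (length u) b))
... | alternating x eq = subst BorderBehaviour (sym eq) (borderBehaviour-alt x (length u))
... | irregular nc na  = ψ-invariant (ξ u ^ suc (suc (length u)) * - φ u) (λ a b →
  cong₂ _*_ (cong₂ _^_ (ξ-border-irregular u nc na a b) (length-frame a u b)) (φ-border-nonConstant u nc a b))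

slope-self : ∀ a → slope a a ≡ 0ℤ
slope-self 𝟘 = refl
slope-self 𝟙 = refl

¬colourable-same-ends : ∀ u → Sloped u → ∀ a → Colourable (a ∷ u ++ [ a ]) → ⊥
¬colourable-same-ends u h a c =
  c (cong (λ z → z ^ length (a ∷ u ++ [ a ]) * φ (a ∷ u ++ [ a ])) (trans (h a a) (slope-self a)))

¬colourable-both-right : ∀ u → Sloped u → ∀ a → Colourable (a ∷ u ++ [ 𝟘 ]) → Colourable (a ∷ u ++ [ 𝟙 ]) → ⊥
¬colourable-both-right u h 𝟘 c₀ _ = ¬colourable-same-ends u h 𝟘 c₀
¬colourable-both-right u h 𝟙 _ c₁ = ¬colourable-same-ends u h 𝟙 c₁

¬colourable-both-left : ∀ u → Sloped u → ∀ b → Colourable (𝟘 ∷ u ++ [ b ]) → Colourable (𝟙 ∷ u ++ [ b ]) → ⊥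
¬colourable-both-left u h 𝟘 c₀ _ = ¬colourable-same-ends u h 𝟘 c₀
¬colourable-both-left u h 𝟙 _ c₁ = ¬colourable-same-ends u h 𝟙 c₁

theorem7p9 : (w : Str) →
    ((Colourable (w ++ [ 𝟘 ]) → Colourable (w ++ [ 𝟙 ]) → ψ (w ++ [ 𝟘 ]) ≡ ψ (w ++ [ 𝟙 ]))
    × (Colourable (𝟘 ∷ w) → Colourable (𝟙 ∷ w) → ψ (𝟘 ∷ w) ≡ ψ (𝟙 ∷ w)))
theorem7p9 w = extend-right w , extend-left w
  where
  extend-right : ∀ w → Colourable (w ++ [ 𝟘 ]) → Colourable (w ++ [ 𝟙 ]) → ψ (w ++ [ 𝟘 ]) ≡ ψ (w ++ [ 𝟙 ])
  extend-right []      c₀ _  = ⊥-elim (c₀ refl)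
  extend-right (a ∷ u) c₀ c₁ with borderBehaviour u
  ... | sloped h          = ⊥-elim (¬colourable-both-right u h a c₀ c₁)
  ... | ψ-invariant _ h   = trans (h a 𝟘) (sym (h a 𝟙))

  extend-left : ∀ w → Colourable (𝟘 ∷ w) → Colourable (𝟙 ∷ w) → ψ (𝟘 ∷ w) ≡ ψ (𝟙 ∷ w)
  extend-left w with initLast w
  ... | []      = λ c₀ _ → ⊥-elim (c₀ refl)
  ... | u ∷ʳ′ b with borderBehaviour u
  ...   | sloped h        = λ c₀ c₁ → ⊥-elim (¬colourable-both-left u h b c₀ c₁)
  ...   | ψ-invariant _ h = λ _ _ → trans (h 𝟘 b) (sym (h 𝟙 b))
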